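{- Let $r,s$ be coprime positive integers and $c$ a positive integer. If $\lambda$ and $\mu$ are partitions with $M_{r,s,c}(\lambda)=M_{r,s,c}(\mu)$, then $|\lambda|=|\mu|$.
   Context: For a partition $\lambda$ (with $\lambda_i=0$ beyond its length $\ell$), the boundary graph $b(\lambda)$ is the directed multigraph on lattice points with edges labelled South or East: for integers $x,y\ge0$ there is a south edge $(x,y+1)\to(x,y)$ if either $x=0$ and $y\ge\ell$, or $x>0$ and $\lambda_{y+1}=x$; and an east edge $(x,y)\to(x+1,y)$ if either $y=0$ and $x\ge\lambda_1$, or $y>0$ and $\lambda_{y+1}\le x<\lambda_y$. $M_{r,s,c}(\lambda)$ is obtained from $b(\lambda)$ by identifying vertices $(x_1,y_1),(x_2,y_2)$ whenever $sx_1+ry_1=sx_2+ry_2$ and $x_1-y_1\equiv x_2-y_2\pmod c$ (class denoted $(v,[i])$, $v=sx+ry$, $[i]=x-y\bmod c$), edges keeping their labels. Equality of such multigraphs means the same vertices and the same number of edges of each label between each ordered pair of vertices. -}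

module Defs where

open import Data.Nat using (ℕ; zero; suc; _+_; _*_; _∸_; _≤_; _<_; _≥_; NonZero)
open import Data.Nat.Properties using (_≟_; _≤?_; _<?_)
open import Data.Integer.Base using (ℤ; +_; _-_; _%ℕ_)
open import Data.List using (List; []; _∷_; length)
open import Data.Nat.ListAction using (sum)
open import Data.List.Relation.Unary.All using (All)
open import Data.List.Relation.Unary.Linked using (Linked)
open import Data.Bool using (Bool; true; false; _∧_; _∨_; if_then_else_)
open import Relation.Nullary.Decidable using (⌊_⌋)
open import Data.Product using (_×_)

IsPartition : List ℕ → Set
IsPartition p = Linked _≥_ p × All (λ k → 0 < k) p

size : List ℕ → ℕ
size = sum

-- part p n = λ_{n+1}  (0 beyond the length)
part : List ℕ → ℕ → ℕ
part []       _       = 0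
part (k ∷ _)  zero    = k
part (_ ∷ ks) (suc n) = part ks n

data Label : Set where
  South East : Label

-- south edge (x,y+1) → (x,y) exists in b(λ)
southEdge : List ℕ → ℕ → ℕ → Bool
southEdge p zero    y = ⌊ length p ≤? y ⌋
southEdge p (suc x) y = ⌊ part p y ≟ suc x ⌋

-- east edge (x,y) → (x+1,y) exists in b(λ)
eastEdge : List ℕ → ℕ → ℕ → Bool
eastEdge p x zero    = ⌊ part p 0 ≤? x ⌋
eastEdge p x (suc y) = ⌊ part p (suc y) ≤? x ⌋ ∧ ⌊ x <? part p y ⌋

edgeAt : Label → List ℕ → ℕ → ℕ → Bool
edgeAt South = southEdge
edgeAt East  = eastEdge

srcX srcY tgtX tgtY : Label → ℕ → ℕ → ℕ
srcX _ x y = x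
srcY South x y = suc y
srcY East  x y = y
tgtX South x y = x
tgtX East  x y = suc x
tgtY _ x y = y

classV : ℕ → ℕ → ℕ → ℕ → ℕ
classV r s x y = s * x + r * y

classI : (c : ℕ) → .{{NonZero c}} → ℕ → ℕ → ℕ
classI c x y = ((+ x) - (+ y)) %ℕ c

sameClass : (r s c : ℕ) → .{{NonZero c}} → ℕ → ℕ → ℕ → ℕ → Bool
sameClass r s c v i x y = ⌊ classV r s x y ≟ v ⌋ ∧ ⌊ classI c x y ≟ i ⌋

sumUpTo : ℕ → (ℕ → ℕ) → ℕ
sumUpTo zero    f = f 0
sumUpTo (suc n) f = sumUpTo n f + f (suc n)

b2n : Bool → ℕ
b2n true  = 1
b2n false = 0

-- Every contributing lattice point has x,y ≤ v₁ + v₂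
-- (as r,s ≥ 1), so the bounded sum counts all of them.
edgeCount : (r s c : ℕ) → .{{NonZero c}} → List ℕ → Label → ℕ → ℕ → ℕ → ℕ → ℕ
edgeCount r s c p L v₁ i₁ v₂ i₂ =
  sumUpTo (v₁ + v₂) λ x → sumUpTo (v₁ + v₂) λ y →
    b2n (edgeAt L p x y
         ∧ sameClass r s c v₁ i₁ (srcX L x y) (srcY L x y)
         ∧ sameClass r s c v₂ i₂ (tgtX L x y) (tgtY L x y))

-- Equality of multigraphs: same edge multiplicities for every label and ordered pair
-- of classes (this also forces the same vertex sets, since every vertex lies on an edge).
MEq : (r s c : ℕ) → .{{NonZero c}} → List ℕ → List ℕ → Set
MEq r s c p q = ∀ (L : Label) (v₁ i₁ v₂ i₂ : ℕ) →
  edgeCount r s c p L v₁ i₁ v₂ i₂ ≡ edgeCount r s c q L v₁ i₁ v₂ i₂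
  where open import Relation.Binary.PropositionalEquality using (_≡_)

-- Forgetting the residues, M_{r,s,c}(λ) still knows, for every v, how many south edges of b(λ)
-- go from the line s x + r y = v to the line s x + r y = v − r.  For a list of positive parts
-- the south edges are exactly (λ_{y+1}, y+1) → (λ_{y+1}, y), one per row y, with source value
-- s λ_{y+1} + r (y+1).  Summing these values over the edges whose value is at most a large N
-- gives s |λ| plus a quantity depending only on r and N, so s |λ| = s |μ|.
module Submission where

open import Defs
open import Data.Nat using (ℕ; _<_; NonZero)
open import Data.Nat.Coprimality using (Coprime)
open import Data.List using (List)
open import Relation.Binary.PropositionalEquality using (_≡_)

open import Data.Nat using (zero; suc; _+_; _*_; _∸_; _≤_; z≤n; s≤s; s≤s⁻¹; z<s; pred; >-nonZero)
open import Data.Nat.Properties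
open import Data.Nat.Tactic.RingSolver using (solve-∀)
open import Data.Nat.ListAction using (sum)
open import Data.List using ([]; _∷_; length)
open import Data.List.Relation.Unary.All using (All; _∷_)
open import Data.Bool using (Bool; true; false; _∧_)
open import Data.Product using (_×_; _,_)
open import Data.Sum using (inj₁; inj₂)
open import Data.Empty using (⊥-elim)
import Data.Integer.Base as ℤ
open import Data.Integer.DivMod using (n%ℕd<d)
open import Function.Bundles using (mk⇔)
open import Relation.Nullary using (¬_; yes; no)
open import Relation.Nullary.Decidable using (Dec; ⌊_⌋; isYes≗does; dec-true; dec-false; does-⇔)
open import Relation.Binary.PropositionalEquality using (refl; sym; trans; cong; cong₂; module ≡-Reasoning)
open import Algebra.Properties.CommutativeSemigroup +-commutativeSemigroup using (interchange)

⌊⌋-true : ∀ {P : Set} (P? : Dec P) → P → ⌊ P? ⌋ ≡ true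
⌊⌋-true P? p = trans (isYes≗does P?) (dec-true P? p)

⌊⌋-false : ∀ {P : Set} (P? : Dec P) → ¬ P → ⌊ P? ⌋ ≡ false
⌊⌋-false P? ¬p = trans (isYes≗does P?) (dec-false P? ¬p)

sumUpTo-cong : ∀ n {f g : ℕ → ℕ} → (∀ k → k ≤ n → f k ≡ g k) → sumUpTo n f ≡ sumUpTo n g
sumUpTo-cong zero    f≗g = f≗g 0 z≤n
sumUpTo-cong (suc n) f≗g =
  cong₂ _+_ (sumUpTo-cong n (λ k k≤n → f≗g k (m≤n⇒m≤1+n k≤n))) (f≗g (suc n) ≤-refl)

sumUpTo-zero : ∀ n {f : ℕ → ℕ} → (∀ k → k ≤ n → f k ≡ 0) → sumUpTo n f ≡ 0
sumUpTo-zero zero    f≗0 = f≗0 0 z≤n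
sumUpTo-zero (suc n) f≗0 =
  cong₂ _+_ (sumUpTo-zero n (λ k k≤n → f≗0 k (m≤n⇒m≤1+n k≤n))) (f≗0 (suc n) ≤-refl)

sumUpTo-+ : ∀ n (f g : ℕ → ℕ) → sumUpTo n (λ k → f k + g k) ≡ sumUpTo n f + sumUpTo n g
sumUpTo-+ zero    f g = refl
sumUpTo-+ (suc n) f g = trans (cong (_+ (f (suc n) + g (suc n))) (sumUpTo-+ n f g))
  (interchange (sumUpTo n f) (sumUpTo n g) (f (suc n)) (g (suc n)))

sumUpTo-*ˡ : ∀ n a (f : ℕ → ℕ) → a * sumUpTo n f ≡ sumUpTo n (λ k → a * f k)
sumUpTo-*ˡ zero    a f = refl
sumUpTo-*ˡ (suc n) a f =
  trans (*-distribˡ-+ a (sumUpTo n f) (f (suc n))) (cong (_+ a * f (suc n)) (sumUpTo-*ˡ n a f))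

sumUpTo-swap : ∀ m n (f : ℕ → ℕ → ℕ) →
  sumUpTo m (λ i → sumUpTo n (f i)) ≡ sumUpTo n (λ j → sumUpTo m (λ i → f i j))
sumUpTo-swap zero    n f = refl
sumUpTo-swap (suc m) n f = trans (cong (_+ sumUpTo n (f (suc m))) (sumUpTo-swap m n f))
  (sym (sumUpTo-+ n (λ j → sumUpTo m (λ i → f i j)) (f (suc m))))

sumUpTo-swap² : ∀ l m n (f : ℕ → ℕ → ℕ → ℕ) →
  sumUpTo l (λ i → sumUpTo m (λ j → sumUpTo n (f i j)))
    ≡ sumUpTo m (λ j → sumUpTo n (λ k → sumUpTo l (λ i → f i j k)))
sumUpTo-swap² l m n f =
  trans (sumUpTo-swap l m _) (sumUpTo-cong m (λ j _ → sumUpTo-swap l n (λ i → f i j)))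

sumUpTo-suc : ∀ n (f : ℕ → ℕ) → sumUpTo (suc n) f ≡ f 0 + sumUpTo n (λ k → f (suc k))
sumUpTo-suc zero    f = refl
sumUpTo-suc (suc n) f = trans (cong (_+ f (suc (suc n))) (sumUpTo-suc n f))
  (+-assoc (f 0) (sumUpTo n (λ k → f (suc k))) (f (suc (suc n))))

sumUpTo-extend : ∀ {f : ℕ → ℕ} m n → (∀ k → m < k → f k ≡ 0) → m ≤ n → sumUpTo n f ≡ sumUpTo m f
sumUpTo-extend m zero    f≗0 z≤n = refl
sumUpTo-extend m (suc n) f≗0 m≤1+n with m≤n⇒m<n∨m≡n m≤1+n
... | inj₂ refl  = refl
... | inj₁ m<1+n = trans (cong₂ _+_ (sumUpTo-extend m n f≗0 (s≤s⁻¹ m<1+n)) (f≗0 (suc n) m<1+n))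
                         (+-identityʳ _)

sumUpTo-indicator : ∀ n a (g : ℕ → ℕ) →
  sumUpTo n (λ k → b2n ⌊ a ≟ k ⌋ * g k) ≡ b2n ⌊ a ≤? n ⌋ * g a
sumUpTo-indicator zero zero    g = refl
sumUpTo-indicator zero (suc a) g = refl
sumUpTo-indicator (suc n) a g rewrite sumUpTo-indicator n a g
  with a ≟ suc n | a ≤? n | a ≤? suc n
... | yes refl | yes 1+n≤n | _         = ⊥-elim (n≮n n 1+n≤n)
... | yes refl | no _      | yes _     = refl
... | yes refl | no _      | no n≰n    = ⊥-elim (n≰n ≤-refl)
... | no _     | yes _     | yes _     = +-identityʳ _
... | no _     | yes a≤n   | no a≰1+n  = ⊥-elim (a≰1+n (m≤n⇒m≤1+n a≤n))
... | no a≢1+n | no a≰n    | yes a≤1+n = ⊥-elim (a≰n (s≤s⁻¹ (≤∧≢⇒< a≤1+n a≢1+n)))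
... | no _     | no _      | no _      = refl

sumUpTo-indicator-≤ : ∀ {n a} (g : ℕ → ℕ) → a ≤ n → sumUpTo n (λ k → b2n ⌊ a ≟ k ⌋ * g k) ≡ g a
sumUpTo-indicator-≤ {n} {a} g a≤n = begin
  sumUpTo n (λ k → b2n ⌊ a ≟ k ⌋ * g k)  ≡⟨ sumUpTo-indicator n a g ⟩
  b2n ⌊ a ≤? n ⌋ * g a                   ≡⟨ cong (λ b → b2n b * g a) (⌊⌋-true (a ≤? n) a≤n) ⟩
  1 * g a                                ≡⟨ *-identityˡ (g a) ⟩
  g a                                    ∎
  where open ≡-Reasoning

b2n-∧ : ∀ a b → b2n (a ∧ b) ≡ b2n a * b2n b
b2n-∧ true  b = sym (*-identityˡ (b2n b))
b2n-∧ false b = refl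

sumUpTo-indicator²-∧ : ∀ {n i j} (e a b : Bool) → i ≤ n → j ≤ n →
  sumUpTo n (λ k → sumUpTo n (λ l → b2n (e ∧ (a ∧ ⌊ i ≟ k ⌋) ∧ (b ∧ ⌊ j ≟ l ⌋)))) ≡ b2n (e ∧ a ∧ b)
sumUpTo-indicator²-∧ {n} {i} {j} e a b i≤n j≤n = begin
  sumUpTo n (λ k → sumUpTo n (λ l → b2n (e ∧ (a ∧ ⌊ i ≟ k ⌋) ∧ (b ∧ ⌊ j ≟ l ⌋))))
    ≡⟨ sumUpTo-cong n (λ k _ → sumUpTo-cong n (λ l _ → factor ⌊ i ≟ k ⌋ ⌊ j ≟ l ⌋)) ⟩
  sumUpTo n (λ k → sumUpTo n (λ l → b2n ⌊ j ≟ l ⌋ * (b2n ⌊ i ≟ k ⌋ * b2n (e ∧ a ∧ b))))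
    ≡⟨ sumUpTo-cong n (λ k _ → sumUpTo-indicator-≤ _ j≤n) ⟩
  sumUpTo n (λ k → b2n ⌊ i ≟ k ⌋ * b2n (e ∧ a ∧ b))
    ≡⟨ sumUpTo-indicator-≤ _ i≤n ⟩
  b2n (e ∧ a ∧ b) ∎
  where
  open ≡-Reasoning
  factor : ∀ u w → b2n (e ∧ (a ∧ u) ∧ (b ∧ w)) ≡ b2n w * (b2n u * b2n (e ∧ a ∧ b))
  factor u w
    rewrite b2n-∧ e ((a ∧ u) ∧ (b ∧ w)) | b2n-∧ (a ∧ u) (b ∧ w) | b2n-∧ a u | b2n-∧ b w
          | b2n-∧ e (a ∧ b) | b2n-∧ a b
    = rearrange (b2n e) (b2n a) (b2n u) (b2n b) (b2n w)
    where
    rearrange : ∀ e a i b j → e * ((a * i) * (b * j)) ≡ j * (i * (e * (a * b)))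
    rearrange = solve-∀

-- Edge multiplicities of M_{r,s,1}(λ), in which vertices are identified by v = s x + r y alone.
lineCount : (r s : ℕ) → List ℕ → Label → ℕ → ℕ → ℕ
lineCount r s p L v₁ v₂ =
  sumUpTo (v₁ + v₂) λ x → sumUpTo (v₁ + v₂) λ y →
    b2n (edgeAt L p x y ∧ ⌊ classV r s (srcX L x y) (srcY L x y) ≟ v₁ ⌋
                        ∧ ⌊ classV r s (tgtX L x y) (tgtY L x y) ≟ v₂ ⌋)

classI≤pred : ∀ c .{{_ : NonZero c}} x y → classI c x y ≤ pred c
classI≤pred c x y = <⇒≤pred (n%ℕd<d (ℤ.+ x ℤ.- ℤ.+ y) c)

sum-residues-edgeCount : ∀ r s c .{{_ : NonZero c}} p L v₁ v₂ →
  sumUpTo (pred c) (λ i₁ → sumUpTo (pred c) (λ i₂ → edgeCount r s c p L v₁ i₁ v₂ i₂))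
    ≡ lineCount r s p L v₁ v₂
sum-residues-edgeCount r s c p L v₁ v₂ = begin
  sumUpTo (pred c) (λ i₁ → sumUpTo (pred c) (λ i₂ → sumUpTo B (λ x → sumUpTo B (edge i₁ i₂ x))))
    ≡⟨ sumUpTo-cong (pred c) (λ i₁ _ → sumUpTo-swap² (pred c) B B (edge i₁)) ⟩
  sumUpTo (pred c) (λ i₁ → sumUpTo B (λ x → sumUpTo B (λ y → sumUpTo (pred c) (λ i₂ → edge i₁ i₂ x y))))
    ≡⟨ sumUpTo-swap² (pred c) B B (λ i₁ x y → sumUpTo (pred c) (λ i₂ → edge i₁ i₂ x y)) ⟩
  sumUpTo B (λ x → sumUpTo B (λ y → sumUpTo (pred c) (λ i₁ → sumUpTo (pred c) (λ i₂ → edge i₁ i₂ x y))))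
    ≡⟨ sumUpTo-cong B (λ x _ → sumUpTo-cong B (λ y _ →
         sumUpTo-indicator²-∧ (edgeAt L p x y)
           ⌊ classV r s (srcX L x y) (srcY L x y) ≟ v₁ ⌋ ⌊ classV r s (tgtX L x y) (tgtY L x y) ≟ v₂ ⌋
           (classI≤pred c (srcX L x y) (srcY L x y)) (classI≤pred c (tgtX L x y) (tgtY L x y)))) ⟩
  lineCount r s p L v₁ v₂ ∎
  where
  open ≡-Reasoning
  B : ℕ
  B = v₁ + v₂
  edge : ℕ → ℕ → ℕ → ℕ → ℕ
  edge i₁ i₂ x y = b2n (edgeAt L p x y ∧ sameClass r s c v₁ i₁ (srcX L x y) (srcY L x y)
                                       ∧ sameClass r s c v₂ i₂ (tgtX L x y) (tgtY L x y))

part-beyond-length : ∀ p y → length p ≤ y → part p y ≡ 0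
part-beyond-length []       y       _         = refl
part-beyond-length (k ∷ ks) (suc y) (s≤s ℓ≤y) = part-beyond-length ks y ℓ≤y

part≡0⇒length≤ : ∀ p y → All (0 <_) p → part p y ≡ 0 → length p ≤ y
part≡0⇒length≤ []       y       _          _  = z≤n
part≡0⇒length≤ (k ∷ ks) zero    (k>0 ∷ _)  k≡0 = ⊥-elim (>⇒≢ k>0 k≡0)
part≡0⇒length≤ (k ∷ ks) (suc y) (_ ∷ ks>0) eq = s≤s (part≡0⇒length≤ ks y ks>0 eq)

part>0⇒<length : ∀ p y → 0 < part p y → y < length p
part>0⇒<length (k ∷ ks) zero    _   = s≤s z≤n
part>0⇒<length (k ∷ ks) (suc y) pos = s≤s (part>0⇒<length ks y pos)

part≤sum : ∀ p y → part p y ≤ sum p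
part≤sum []       y       = z≤n
part≤sum (k ∷ ks) zero    = m≤m+n k (sum ks)
part≤sum (k ∷ ks) (suc y) = ≤-trans (part≤sum ks y) (m≤n+m (sum ks) k)

sumUpTo-part : ∀ p n → length p ≤ n → sumUpTo n (part p) ≡ sum p
sumUpTo-part []       n       _         = sumUpTo-zero n (λ _ _ → refl)
sumUpTo-part (k ∷ ks) (suc n) (s≤s ℓ≤n) =
  trans (sumUpTo-suc n (part (k ∷ ks))) (cong (k +_) (sumUpTo-part ks n ℓ≤n))

southEdge-positive : ∀ p → All (0 <_) p → ∀ x y → southEdge p x y ≡ ⌊ part p y ≟ x ⌋
southEdge-positive p p>0 zero y =
  trans (isYes≗does (length p ≤? y)) (trans
    (does-⇔ (mk⇔ (part-beyond-length p y) (part≡0⇒length≤ p y p>0)) (length p ≤? y) (part p y ≟ 0))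
    (sym (isYes≗does (part p y ≟ 0))))
southEdge-positive p p>0 (suc x) y = refl

cutoff : ℕ → ℕ → ℕ
cutoff N a = b2n ⌊ a ≤? N ⌋ * a

cutoff-+ : ∀ N s a t → (0 < a → s * a + t ≤ N) → cutoff N (s * a + t) ≡ s * a + cutoff N t
cutoff-+ N s zero t _ rewrite *-zeroʳ s = refl
cutoff-+ N s (suc a) t row≤N
  rewrite ⌊⌋-true (s * suc a + t ≤? N) (row≤N z<s)
        | ⌊⌋-true (t ≤? N) (≤-trans (m≤n+m t (s * suc a)) (row≤N z<s))
  = trans (*-identityˡ _) (cong (s * suc a +_) (sym (*-identityˡ t)))

module SouthEdges (r s : ℕ) (r>0 : 0 < r) (s>0 : 0 < s) where

  southAt : List ℕ → ℕ → ℕ → ℕ → ℕ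
  southAt p v x y = b2n ⌊ part p y ≟ x ⌋ * b2n ⌊ classV r s x (suc y) ≟ v ⌋

  classV-suc : ∀ x y → classV r s x (suc y) ≡ r + classV r s x y
  classV-suc x y = shift (s * x) r y
    where
    shift : ∀ a r y → a + r * suc y ≡ r + (a + r * y)
    shift = solve-∀

  classV-suc-bounds : ∀ {x y v} → classV r s x (suc y) ≡ v → x ≤ v × y ≤ v
  classV-suc-bounds {x} {y} refl =
    ≤-trans (m≤n*m x s {{>-nonZero s>0}}) (m≤m+n (s * x) (r * suc y)) ,
    ≤-trans (≤-trans (n≤1+n y) (m≤n*m (suc y) r {{>-nonZero r>0}})) (m≤n+m (r * suc y) (s * x))

  southAt≡0 : ∀ p {v} x y → ¬ (x ≤ v × y ≤ v) → southAt p v x y ≡ 0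
  southAt≡0 p {v} x y outside
    rewrite ⌊⌋-false (classV r s x (suc y) ≟ v) (λ eq → outside (classV-suc-bounds eq))
    = *-zeroʳ (b2n ⌊ part p y ≟ x ⌋)

  southEdge-southAt : ∀ p → All (0 <_) p → ∀ v x y →
    b2n (southEdge p x y ∧ ⌊ classV r s x (suc y) ≟ v ⌋ ∧ ⌊ classV r s x y ≟ v ∸ r ⌋)
      ≡ southAt p v x y
  southEdge-southAt p p>0 v x y rewrite southEdge-positive p p>0 x y
    with part p y ≟ x | classV r s x (suc y) ≟ v
  ... | no _  | _     = refl
  ... | yes _ | no _  = refl
  ... | yes _ | yes e
    rewrite ⌊⌋-true (classV r s x y ≟ v ∸ r)
                     (sym (trans (cong (_∸ r) (trans (sym e) (classV-suc x y))) (m+n∸m≡n r _)))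
    = refl

  lineCount-south : ∀ p → All (0 <_) p → ∀ {v N} → v ≤ N →
    lineCount r s p South v (v ∸ r) ≡ sumUpTo N (λ x → sumUpTo N (southAt p v x))
  lineCount-south p p>0 {v} {N} v≤N = begin
    lineCount r s p South v (v ∸ r)
      ≡⟨ sumUpTo-cong B (λ x _ → sumUpTo-cong B (λ y _ → southEdge-southAt p p>0 v x y)) ⟩
    sumUpTo B (λ x → sumUpTo B (southAt p v x))
      ≡⟨ sumUpTo-cong B (λ x _ → enlarge (λ y v<y → southAt≡0 p x y (λ (_ , y≤v) → <⇒≱ v<y y≤v))) ⟩
    sumUpTo B (λ x → sumUpTo N (southAt p v x))
      ≡⟨ enlarge (λ x v<x → sumUpTo-zero N (λ y _ → southAt≡0 p x y (λ (x≤v , _) → <⇒≱ v<x x≤v))) ⟩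
    sumUpTo N (λ x → sumUpTo N (southAt p v x)) ∎
    where
    open ≡-Reasoning
    B : ℕ
    B = v + (v ∸ r)
    enlarge : ∀ {f : ℕ → ℕ} → (∀ k → v < k → f k ≡ 0) → sumUpTo B f ≡ sumUpTo N f
    enlarge f≗0 = trans (sumUpTo-extend v B f≗0 (m≤m+n v _)) (sym (sumUpTo-extend v N f≗0 v≤N))

  southWeight : ℕ → List ℕ → ℕ
  southWeight N p = sumUpTo N (λ v → v * lineCount r s p South v (v ∸ r))

  MEq⇒southWeight≡ : ∀ c .{{_ : NonZero c}} {p q} N → MEq r s c p q → southWeight N p ≡ southWeight N q
  MEq⇒southWeight≡ c {p} {q} N p≅q = sumUpTo-cong N (λ v _ → cong (v *_)
    (trans (sym (sum-residues-edgeCount r s c p South v (v ∸ r)))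
      (trans (sumUpTo-cong (pred c) (λ i₁ _ → sumUpTo-cong (pred c) (λ i₂ _ → p≅q South v i₁ (v ∸ r) i₂)))
             (sum-residues-edgeCount r s c q South v (v ∸ r)))))

  southWeight-rows : ∀ p → All (0 <_) p → ∀ N → sum p ≤ N →
    southWeight N p ≡ sumUpTo N (λ y → cutoff N (classV r s (part p y) (suc y)))
  southWeight-rows p p>0 N Σp≤N = begin
    southWeight N p
      ≡⟨ sumUpTo-cong N (λ v v≤N → cong (v *_) (lineCount-south p p>0 v≤N)) ⟩
    sumUpTo N (λ v → v * sumUpTo N (λ x → sumUpTo N (southAt p v x)))
      ≡⟨ sumUpTo-cong N (λ v _ → trans (sumUpTo-*ˡ N v _)
                                       (sumUpTo-cong N (λ x _ → sumUpTo-*ˡ N v (southAt p v x)))) ⟩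
    sumUpTo N (λ v → sumUpTo N (λ x → sumUpTo N (λ y → v * southAt p v x y)))
      ≡⟨ sumUpTo-swap² N N N (λ v x y → v * southAt p v x y) ⟩
    sumUpTo N (λ x → sumUpTo N (λ y → sumUpTo N (λ v → v * southAt p v x y)))
      ≡⟨ sumUpTo-cong N (λ x _ → sumUpTo-cong N (λ y _ → weigh x y)) ⟩
    sumUpTo N (λ x → sumUpTo N (λ y → b2n ⌊ part p y ≟ x ⌋ * cutoff N (classV r s x (suc y))))
      ≡⟨ sumUpTo-swap N N (λ x y → b2n ⌊ part p y ≟ x ⌋ * cutoff N (classV r s x (suc y))) ⟩
    sumUpTo N (λ y → sumUpTo N (λ x → b2n ⌊ part p y ≟ x ⌋ * cutoff N (classV r s x (suc y))))
      ≡⟨ sumUpTo-cong N (λ y _ → sumUpTo-indicator-≤ _ (≤-trans (part≤sum p y) Σp≤N)) ⟩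
    sumUpTo N (λ y → cutoff N (classV r s (part p y) (suc y))) ∎
    where
    open ≡-Reasoning
    weigh : ∀ x y →
      sumUpTo N (λ v → v * southAt p v x y) ≡ b2n ⌊ part p y ≟ x ⌋ * cutoff N (classV r s x (suc y))
    weigh x y = begin
      sumUpTo N (λ v → v * (P * b2n ⌊ V ≟ v ⌋))  ≡⟨ sumUpTo-cong N (λ v _ → reorder v P _) ⟩
      sumUpTo N (λ v → b2n ⌊ V ≟ v ⌋ * (P * v))  ≡⟨ sumUpTo-indicator N V (P *_) ⟩
      b2n ⌊ V ≤? N ⌋ * (P * V)                   ≡⟨ exchange (b2n ⌊ V ≤? N ⌋) P V ⟩
      P * cutoff N V                             ∎
      where
      P V : ℕ
      P = b2n ⌊ part p y ≟ x ⌋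
      V = classV r s x (suc y)
      reorder : ∀ a b c → a * (b * c) ≡ c * (b * a)
      reorder = solve-∀
      exchange : ∀ a b c → a * (b * c) ≡ b * (a * c)
      exchange = solve-∀

  southWeight-formula : ∀ p → All (0 <_) p → ∀ N → s * sum p + r * length p ≤ N →
    southWeight N p ≡ s * sum p + sumUpTo N (λ y → cutoff N (r * suc y))
  southWeight-formula p p>0 N bound = begin
    southWeight N p
      ≡⟨ southWeight-rows p p>0 N Σp≤N ⟩
    sumUpTo N (λ y → cutoff N (s * part p y + r * suc y))
      ≡⟨ sumUpTo-cong N (λ y _ → cutoff-+ N s (part p y) (r * suc y) (row≤N y)) ⟩
    sumUpTo N (λ y → s * part p y + cutoff N (r * suc y))
      ≡⟨ sumUpTo-+ N (λ y → s * part p y) (λ y → cutoff N (r * suc y)) ⟩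
    sumUpTo N (λ y → s * part p y) + rest
      ≡⟨ cong (_+ rest) (sym (sumUpTo-*ˡ N s (part p))) ⟩
    s * sumUpTo N (part p) + rest
      ≡⟨ cong (λ t → s * t + rest) (sumUpTo-part p N ℓ≤N) ⟩
    s * sum p + rest ∎
    where
    open ≡-Reasoning
    rest : ℕ
    rest = sumUpTo N (λ y → cutoff N (r * suc y))
    Σp≤N : sum p ≤ N
    Σp≤N = ≤-trans (m≤n*m (sum p) s {{>-nonZero s>0}}) (≤-trans (m≤m+n _ _) bound)
    ℓ≤N : length p ≤ N
    ℓ≤N = ≤-trans (m≤n*m (length p) r {{>-nonZero r>0}}) (≤-trans (m≤n+m _ _) bound)
    row≤N : ∀ y → 0 < part p y → s * part p y + r * suc y ≤ N
    row≤N y pos = ≤-trans (+-mono-≤ (*-monoʳ-≤ s (part≤sum p y)) (*-monoʳ-≤ r (part>0⇒<length p y pos))) bound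

corollary4p25 : (r s c : ℕ) → .{{_ : NonZero c}} → 0 < r → 0 < s → Coprime r s →
    (lam mu : List ℕ) → IsPartition lam → IsPartition mu →
    MEq r s c lam mu → size lam ≡ size mu
corollary4p25 r s c r>0 s>0 _ lam mu (_ , lam>0) (_ , mu>0) lam≅mu =
  *-cancelˡ-≡ (size lam) (size mu) s {{>-nonZero s>0}} (+-cancelʳ-≡ rest _ _ (begin
    s * size lam + rest  ≡⟨ sym (southWeight-formula lam lam>0 N (bound lam (m≤m+n _ _) (m≤m+n _ _))) ⟩
    southWeight N lam    ≡⟨ MEq⇒southWeight≡ c N lam≅mu ⟩
    southWeight N mu     ≡⟨ southWeight-formula mu mu>0 N (bound mu (m≤n+m _ _) (m≤n+m _ _)) ⟩
    s * size mu + rest   ∎))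
  where
  open SouthEdges r s r>0 s>0
  open ≡-Reasoning
  N rest : ℕ
  N = s * (size lam + size mu) + r * (length lam + length mu)
  rest = sumUpTo N (λ y → cutoff N (r * suc y))
  bound : ∀ p → size p ≤ size lam + size mu → length p ≤ length lam + length mu →
          s * size p + r * length p ≤ N
  bound p Σ≤ ℓ≤ = +-mono-≤ (*-monoʳ-≤ s Σ≤) (*-monoʳ-≤ r ℓ≤)
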